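{- Let $n, d \in \mathbb{N}$ (with $n \ge 2$), and let $g$ have maximal $\mathbf{D}[g]$ over all $(n-1,d)$-PTFs. Then for every $(n,d)$-PTF $f$, $\mathbf{D}[f] \le \frac{2n}{n-1}\mathbf{D}[g]$.
   Context: A boolean function $f:\{ -1,1\}^n\to\{ -1,1\}$ is an $(n,d)$-PTF if there is a polynomial $p\in\mathbb{R}[x_1,\dots,x_n]$ of degree at most $d$ with $f(x)=\mathrm{sgn}(p(x))$ for all $x\in\{ -1,1\}^n$. The dichromatic count $\mathbf{D}[f]$ is the number of unordered pairs $\{x,y\}$ of points of $\{ -1,1\}^n$ differing in exactly one coordinate with $f(x)\ne f(y)$.
   Formalization: The polynomial $p$ realizing each $(n,d)$-PTF and each $(n-1,d)$-PTF has rational coefficients instead of real ones. -}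

module Defs where

open import Data.Bool using (Bool; true; false; if_then_else_; _xor_)
open import Data.Nat as ℕ using (ℕ; zero; suc)
open import Data.Fin using (Fin)
open import Data.Vec as Vec using (Vec; []; _∷_; lookup; _[_]≔_; allFin)
open import Data.List as List using (List; []; _∷_; _++_; concatMap)
open import Data.Rational using (ℚ; 0ℚ; 1ℚ; -_; _+_; _*_; _<_)
open import Data.Nat.ListAction using (sum)
open import Data.Product using (_×_; _,_; Σ)
open import Relation.Binary.PropositionalEquality using (_≡_)

-- A point of {-1,1}^n: true encodes +1, false encodes -1.
Cube : ℕ → Set
Cube n = Vec Bool n

val : Bool → ℚ
val true  = 1ℚ
val false = - 1ℚ

pow : ℚ → ℕ → ℚ
pow q zero    = 1ℚ
pow q (suc k) = q * pow q k

Monomial : ℕ → Set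
Monomial n = ℚ × Vec ℕ n

Poly : ℕ → Set
Poly n = List (Monomial n)

mdeg : ∀ {n} → Monomial n → ℕ
mdeg (c , e) = Vec.sum e

data DegLe {n : ℕ} (d : ℕ) : Poly n → Set where
  []  : DegLe d []
  _∷_ : ∀ {m ms} → mdeg m ℕ.≤ d → DegLe d ms → DegLe d (m ∷ ms)

evalMono : ∀ {n} → Monomial n → Cube n → ℚ
evalMono (c , e) x = c * Vec.foldr _ _*_ 1ℚ (Vec.zipWith (λ b k → pow (val b) k) x e)

eval : ∀ {n} → Poly n → Cube n → ℚ
eval []       x = 0ℚ
eval (m ∷ ms) x = evalMono m x + eval ms x

SignRep : ∀ {n} → (Cube n → Bool) → Poly n → Set
SignRep f p = ∀ x → (f x ≡ true → 0ℚ < eval p x) × (f x ≡ false → eval p x < 0ℚ)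

IsPTF : (n d : ℕ) → (Cube n → Bool) → Set
IsPTF n d f = Σ (Poly n) λ p → DegLe d p × SignRep f p

allPoints : (n : ℕ) → List (Cube n)
allPoints zero    = [] ∷ []
allPoints (suc n) = List.map (true ∷_) (allPoints n) ++ List.map (false ∷_) (allPoints n)

-- contribution of the edge in direction i at x, counted only from its endpoint
-- with x_i = -1 (so each unordered edge is counted exactly once)
edgeCount : ∀ {n} → (Cube n → Bool) → Cube n → Fin n → ℕ
edgeCount f x i with lookup x i
... | true  = 0
... | false = if f x xor f (x [ i ]≔ true) then 1 else 0

D : ∀ {n} → (Cube n → Bool) → ℕ
D {n} f = sum (concatMap (λ x → List.map (edgeCount f x) (List.allFin n)) (allPoints n))

{-# OPTIONS --safe #-}
module Submission where

-- Fixing the i-th coordinate of an (n,d)-PTF to b ∈ {-1,1} substitutes a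
-- constant into its polynomial, so the restriction is an (n-1,d)-PTF and has
-- at most D[g] dichromatic edges.  An edge in direction j lies in exactly one
-- of the two subcubes {x_i = ±1} when i ≠ j and in neither when i = j, so the
-- 2n restrictions together count every dichromatic edge of f exactly n-1
-- times: (n-1) D[f] = Σ_{i,b} D[f|x_i=b] ≤ 2n D[g].

open import Defs
open import Algebra.Bundles using (CommutativeMonoid)
open import Data.Bool using (Bool; true; false; if_then_else_; _xor_)
open import Data.Nat using (ℕ; zero; suc; _≤_; _*_; _∸_; _+_; s≤s; z≤n)
open import Data.Nat.Properties as ℕ
  using (+-mono-≤; m≤n+m; ≤-trans; +-cancelˡ-≡; *-distribˡ-+; +-0-commutativeMonoid; +-commutativeSemigroup)
import Data.Nat.ListAction as ListAction
open import Data.Nat.ListAction.Properties using (sum-++)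
open import Data.Nat.Tactic.RingSolver using (solve-∀)
open import Data.Fin using (Fin; zero; suc; punchIn)
open import Data.Vec as Vec using (Vec; []; _∷_; lookup; _[_]≔_; insertAt; removeAt; zipWith)
open import Data.Vec.Properties using (insertAt-punchIn; insertAt-removeAt)
open import Data.Vec.Functional as Vector using (Vector)
open import Data.List as List using (List; []; _∷_; concatMap; tabulate)
open import Data.List.Properties using (map-++; map-∘; map-tabulate)
open import Data.Product using (_,_; proj₁; proj₂)
open import Data.Rational as ℚ using (ℚ; 0ℚ; 1ℚ; _<_)
open import Data.Rational.Properties using (*-1-commutativeMonoid) renaming (*-assoc to ℚ-*-assoc)
open import Algebra.Properties.CommutativeMonoid.Sum +-0-commutativeMonoid
  using (sum; sum-syntax; sum-cong-≗; sum-remove; ∑-distrib-+)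
open import Algebra.Properties.CommutativeSemigroup +-commutativeSemigroup using (interchange)
open import Relation.Binary.PropositionalEquality
open import Function using (_∘_; id)

private
  variable
    A B C : Set
    m n k : ℕ

zipWith-insertAt : ∀ (f : A → B → C) (xs : Vec A n) (ys : Vec B n) i x y →
  zipWith f (insertAt xs i x) (insertAt ys i y) ≡ insertAt (zipWith f xs ys) i (f x y)
zipWith-insertAt f xs        ys        zero    x y = refl
zipWith-insertAt f (x′ ∷ xs) (y′ ∷ ys) (suc i) x y = cong (f x′ y′ ∷_) (zipWith-insertAt f xs ys i x y)

[]≔-punchIn-insertAt : ∀ (xs : Vec A n) i (v w : A) j →
  insertAt xs i v [ punchIn i j ]≔ w ≡ insertAt (xs [ j ]≔ w) i v
[]≔-punchIn-insertAt xs       zero    v w j       = refl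
[]≔-punchIn-insertAt (x ∷ xs) (suc i) v w zero    = refl
[]≔-punchIn-insertAt (x ∷ xs) (suc i) v w (suc j) = cong (x ∷_) ([]≔-punchIn-insertAt xs i v w j)

module _ {c ℓ} (M : CommutativeMonoid c ℓ) where
  open CommutativeMonoid M using (Carrier; _≈_; _∙_; ε; ∙-congˡ; commutativeSemigroup)
    renaming (refl to ≈-refl; trans to ≈-trans)
  open import Algebra.Properties.CommutativeSemigroup commutativeSemigroup using (x∙yz≈y∙xz)

  foldr-insertAt : ∀ (xs : Vec Carrier n) i x →
    Vec.foldr′ _∙_ ε (insertAt xs i x) ≈ x ∙ Vec.foldr′ _∙_ ε xs
  foldr-insertAt xs       zero    x = ≈-refl
  foldr-insertAt (y ∷ xs) (suc i) x = ≈-trans (∙-congˡ (foldr-insertAt xs i x)) (x∙yz≈y∙xz y x _)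

∑-const : ∀ n c → ∑[ i < n ] c ≡ n * c
∑-const zero    c = refl
∑-const (suc n) c = cong (c +_) (∑-const n c)

∑-mono-≤ : ∀ {f g : Vector ℕ n} → (∀ i → f i ≤ g i) → sum f ≤ sum g
∑-mono-≤ {zero}  f≤g = z≤n
∑-mono-≤ {suc n} f≤g = +-mono-≤ (f≤g zero) (∑-mono-≤ (f≤g ∘ suc))

∑-sum-removeAt : ∀ (t : Vector ℕ (suc m)) → ∑[ i < suc m ] sum (Vector.removeAt t i) ≡ m * sum t
∑-sum-removeAt {m} t = +-cancelˡ-≡ (sum t) _ _ (begin
  sum t + ∑[ i < suc m ] sum (Vector.removeAt t i)  ≡⟨ sym (∑-distrib-+ t (sum ∘ Vector.removeAt t)) ⟩
  ∑[ i < suc m ] (t i + sum (Vector.removeAt t i))  ≡⟨ sum-cong-≗ (λ i → sym (sum-remove {i = i} t)) ⟩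
  ∑[ i < suc m ] sum t                              ≡⟨ ∑-const (suc m) (sum t) ⟩
  suc m * sum t                                     ∎)
  where open ≡-Reasoning

cubeSum : ∀ n → (Cube n → ℕ) → ℕ
cubeSum zero    φ = φ []
cubeSum (suc n) φ = cubeSum n (φ ∘ (true ∷_)) + cubeSum n (φ ∘ (false ∷_))

sum-map-allPoints : ∀ n (φ : Cube n → ℕ) → ListAction.sum (List.map φ (allPoints n)) ≡ cubeSum n φ
sum-map-allPoints zero    φ = ℕ.+-identityʳ (φ [])
sum-map-allPoints (suc n) φ = begin
  ListAction.sum (List.map φ (List.map (true ∷_) xs List.++ List.map (false ∷_) xs))
    ≡⟨ cong ListAction.sum (map-++ φ (List.map (true ∷_) xs) _) ⟩
  ListAction.sum (List.map φ (List.map (true ∷_) xs) List.++ List.map φ (List.map (false ∷_) xs))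
    ≡⟨ sum-++ (List.map φ (List.map (true ∷_) xs)) _ ⟩
  ListAction.sum (List.map φ (List.map (true ∷_) xs)) + ListAction.sum (List.map φ (List.map (false ∷_) xs))
    ≡⟨ cong₂ _+_ (cong ListAction.sum (sym (map-∘ xs))) (cong ListAction.sum (sym (map-∘ xs))) ⟩
  ListAction.sum (List.map (φ ∘ (true ∷_)) xs) + ListAction.sum (List.map (φ ∘ (false ∷_)) xs)
    ≡⟨ cong₂ _+_ (sum-map-allPoints n _) (sum-map-allPoints n _) ⟩
  cubeSum (suc n) φ ∎
  where
  open ≡-Reasoning
  xs = allPoints n

cubeSum-cong : ∀ n {φ ψ : Cube n → ℕ} → (∀ x → φ x ≡ ψ x) → cubeSum n φ ≡ cubeSum n ψ
cubeSum-cong zero    φ≗ψ = φ≗ψ []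
cubeSum-cong (suc n) φ≗ψ = cong₂ _+_ (cubeSum-cong n (φ≗ψ ∘ (true ∷_))) (cubeSum-cong n (φ≗ψ ∘ (false ∷_)))

cubeSum-*ˡ : ∀ n c (φ : Cube n → ℕ) → cubeSum n (λ x → c * φ x) ≡ c * cubeSum n φ
cubeSum-*ˡ zero    c φ = refl
cubeSum-*ˡ (suc n) c φ = trans (cong₂ _+_ (cubeSum-*ˡ n c _) (cubeSum-*ˡ n c _)) (sym (*-distribˡ-+ c _ _))

cubeSum-∑-comm : ∀ n (φ : Cube n → Fin k → ℕ) →
  cubeSum n (λ x → ∑[ i < k ] φ x i) ≡ ∑[ i < k ] cubeSum n (λ x → φ x i)
cubeSum-∑-comm zero    φ = refl
cubeSum-∑-comm (suc n) φ = trans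
  (cong₂ _+_ (cubeSum-∑-comm n (φ ∘ (true ∷_))) (cubeSum-∑-comm n (φ ∘ (false ∷_))))
  (sym (∑-distrib-+ (λ i → cubeSum n (λ x → φ (true ∷ x) i)) (λ i → cubeSum n (λ x → φ (false ∷ x) i))))

cubeSum-insertAt : ∀ m (i : Fin (suc m)) (φ : Cube (suc m) → ℕ) →
  cubeSum (suc m) φ ≡ cubeSum m (λ y → φ (insertAt y i true)) + cubeSum m (λ y → φ (insertAt y i false))
cubeSum-insertAt m       zero    φ = refl
cubeSum-insertAt (suc m) (suc i) φ = trans
  (cong₂ _+_ (cubeSum-insertAt m i (φ ∘ (true ∷_))) (cubeSum-insertAt m i (φ ∘ (false ∷_))))
  (interchange (at true true) (at true false) (at false true) (at false false))
  where
  at : Bool → Bool → ℕ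
  at a b = cubeSum m (λ y → φ (a ∷ insertAt y i b))

sum-concatMap : ∀ (f : A → List ℕ) xs →
  ListAction.sum (concatMap f xs) ≡ ListAction.sum (List.map (ListAction.sum ∘ f) xs)
sum-concatMap f []       = refl
sum-concatMap f (x ∷ xs) = trans (sum-++ (f x) (concatMap f xs)) (cong (ListAction.sum (f x) +_) (sum-concatMap f xs))

sum-tabulate : ∀ n (h : Fin n → ℕ) → ListAction.sum (tabulate h) ≡ sum h
sum-tabulate zero    h = refl
sum-tabulate (suc n) h = cong (h zero +_) (sum-tabulate n (h ∘ suc))

sum-map-allFin : ∀ n (h : Fin n → ℕ) → ListAction.sum (List.map h (List.allFin n)) ≡ sum h
sum-map-allFin n h = trans (cong ListAction.sum (map-tabulate id h)) (sum-tabulate n h)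

D≡cubeSum : ∀ n (f : Cube n → Bool) → D f ≡ cubeSum n (λ x → ∑[ i < n ] edgeCount f x i)
D≡cubeSum n f = begin
  D f
    ≡⟨ sum-concatMap (λ x → List.map (edgeCount f x) (List.allFin n)) (allPoints n) ⟩
  ListAction.sum (List.map (λ x → ListAction.sum (List.map (edgeCount f x) (List.allFin n))) (allPoints n))
    ≡⟨ sum-map-allPoints n _ ⟩
  cubeSum n (λ x → ListAction.sum (List.map (edgeCount f x) (List.allFin n)))
    ≡⟨ cubeSum-cong n (λ x → sum-map-allFin n (edgeCount f x)) ⟩
  cubeSum n (λ x → ∑[ i < n ] edgeCount f x i) ∎
  where open ≡-Reasoning

restrict : (Cube (suc m) → A) → Fin (suc m) → Bool → Cube m → A
restrict f i b y = f (insertAt y i b)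

edgeCount-if : ∀ (f : Cube n → Bool) x i →
  edgeCount f x i ≡ (if lookup x i then 0 else (if f x xor f (x [ i ]≔ true) then 1 else 0))
edgeCount-if f x i with lookup x i
... | true  = refl
... | false = refl

edgeCount-restrict : ∀ (f : Cube (suc m) → Bool) i b y j →
  edgeCount (restrict f i b) y j ≡ edgeCount f (insertAt y i b) (punchIn i j)
edgeCount-restrict f i b y j = begin
  edgeCount (restrict f i b) y j
    ≡⟨ edgeCount-if (restrict f i b) y j ⟩
  count (lookup y j) (f (insertAt (y [ j ]≔ true) i b))
    ≡⟨ cong₂ count (sym (insertAt-punchIn y i b j)) (cong f (sym ([]≔-punchIn-insertAt y i b true j))) ⟩
  count (lookup (insertAt y i b) (punchIn i j)) (f (insertAt y i b [ punchIn i j ]≔ true))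
    ≡⟨ sym (edgeCount-if f (insertAt y i b) (punchIn i j)) ⟩
  edgeCount f (insertAt y i b) (punchIn i j) ∎
  where
  open ≡-Reasoning
  count : Bool → Bool → ℕ
  count xⱼ fx′ = if xⱼ then 0 else (if f (insertAt y i b) xor fx′ then 1 else 0)

D-restrict-pair : ∀ (f : Cube (suc m) → Bool) i →
  D (restrict f i true) + D (restrict f i false) ≡ cubeSum (suc m) (λ x → sum (Vector.removeAt (edgeCount f x) i))
D-restrict-pair {m} f i = begin
  D (restrict f i true) + D (restrict f i false)
    ≡⟨ cong₂ _+_ (D-restrict true) (D-restrict false) ⟩
  cubeSum m (λ y → E (insertAt y i true)) + cubeSum m (λ y → E (insertAt y i false))
    ≡⟨ sym (cubeSum-insertAt m i E) ⟩
  cubeSum (suc m) E ∎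
  where
  open ≡-Reasoning
  E : Cube (suc m) → ℕ
  E x = sum (Vector.removeAt (edgeCount f x) i)
  D-restrict : ∀ b → D (restrict f i b) ≡ cubeSum m (λ y → E (insertAt y i b))
  D-restrict b = trans (D≡cubeSum m (restrict f i b))
    (cubeSum-cong m (λ y → sum-cong-≗ (edgeCount-restrict f i b y)))

∑-D-restrict : ∀ (f : Cube (suc m) → Bool) →
  ∑[ i < suc m ] (D (restrict f i true) + D (restrict f i false)) ≡ m * D f
∑-D-restrict {m} f = begin
  ∑[ i < suc m ] (D (restrict f i true) + D (restrict f i false))
    ≡⟨ sum-cong-≗ (D-restrict-pair f) ⟩
  ∑[ i < suc m ] cubeSum (suc m) (λ x → sum (Vector.removeAt (edgeCount f x) i))
    ≡⟨ sym (cubeSum-∑-comm (suc m) (λ x i → sum (Vector.removeAt (edgeCount f x) i))) ⟩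
  cubeSum (suc m) (λ x → ∑[ i < suc m ] sum (Vector.removeAt (edgeCount f x) i))
    ≡⟨ cubeSum-cong (suc m) (λ x → ∑-sum-removeAt (edgeCount f x)) ⟩
  cubeSum (suc m) (λ x → m * sum (edgeCount f x))
    ≡⟨ cubeSum-*ˡ (suc m) m (λ x → sum (edgeCount f x)) ⟩
  m * cubeSum (suc m) (λ x → sum (edgeCount f x))
    ≡⟨ cong (m *_) (sym (D≡cubeSum (suc m) f)) ⟩
  m * D f ∎
  where open ≡-Reasoning

restrictMonomial : Fin (suc m) → Bool → Monomial (suc m) → Monomial m
restrictMonomial i b (c , e) = (c ℚ.* pow (val b) (lookup e i) , removeAt e i)

restrictPoly : Fin (suc m) → Bool → Poly (suc m) → Poly m
restrictPoly i b = List.map (restrictMonomial i b)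

evalMono-restrict : ∀ i b (mo : Monomial (suc m)) y →
  evalMono (restrictMonomial i b mo) y ≡ evalMono mo (insertAt y i b)
evalMono-restrict i b (c , e) y = begin
  (c ℚ.* powVal b eᵢ) ℚ.* product (zipWith powVal y (removeAt e i))
    ≡⟨ ℚ-*-assoc c _ _ ⟩
  c ℚ.* (powVal b eᵢ ℚ.* product (zipWith powVal y (removeAt e i)))
    ≡⟨ cong (c ℚ.*_) (sym (foldr-insertAt *-1-commutativeMonoid (zipWith powVal y (removeAt e i)) i _)) ⟩
  c ℚ.* product (insertAt (zipWith powVal y (removeAt e i)) i (powVal b eᵢ))
    ≡⟨ cong (λ v → c ℚ.* product v) (sym (zipWith-insertAt powVal y (removeAt e i) i b eᵢ)) ⟩
  c ℚ.* product (zipWith powVal (insertAt y i b) (insertAt (removeAt e i) i eᵢ))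
    ≡⟨ cong (λ e′ → c ℚ.* product (zipWith powVal (insertAt y i b) e′)) (insertAt-removeAt e i) ⟩
  c ℚ.* product (zipWith powVal (insertAt y i b) e) ∎
  where
  open ≡-Reasoning
  eᵢ = lookup e i
  powVal : Bool → ℕ → ℚ
  powVal x k = pow (val x) k
  product : Vec ℚ n → ℚ
  product = Vec.foldr′ ℚ._*_ 1ℚ

eval-restrict : ∀ i b (p : Poly (suc m)) y → eval (restrictPoly i b p) y ≡ eval p (insertAt y i b)
eval-restrict i b []       y = refl
eval-restrict i b (mo ∷ p) y = cong₂ ℚ._+_ (evalMono-restrict i b mo y) (eval-restrict i b p y)

mdeg-restrict : ∀ i b (mo : Monomial (suc m)) → mdeg (restrictMonomial i b mo) ≤ mdeg mo
mdeg-restrict i b (c , e) = subst (Vec.sum (removeAt e i) ≤_) sum-e (m≤n+m _ (lookup e i))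
  where
  sum-e : lookup e i + Vec.sum (removeAt e i) ≡ Vec.sum e
  sum-e = trans (sym (foldr-insertAt +-0-commutativeMonoid (removeAt e i) i (lookup e i)))
                (cong Vec.sum (insertAt-removeAt e i))

DegLe-restrict : ∀ {d} i b {p : Poly (suc m)} → DegLe d p → DegLe d (restrictPoly i b p)
DegLe-restrict i b []                   = []
DegLe-restrict i b (_∷_ {mo} deg≤ degs) = ≤-trans (mdeg-restrict i b mo) deg≤ ∷ DegLe-restrict i b degs

SignRep-restrict : ∀ {f : Cube (suc m) → Bool} {p} i b → SignRep f p → SignRep (restrict f i b) (restrictPoly i b p)
SignRep-restrict {p = p} i b rep y =
  (λ fy≡true  → subst (0ℚ <_) (sym (eval-restrict i b p y)) (proj₁ (rep (insertAt y i b)) fy≡true)) ,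
  (λ fy≡false → subst (_< 0ℚ) (sym (eval-restrict i b p y)) (proj₂ (rep (insertAt y i b)) fy≡false))

IsPTF-restrict : ∀ {d} {f : Cube (suc m) → Bool} i b → IsPTF (suc m) d f → IsPTF m d (restrict f i b)
IsPTF-restrict i b (p , deg , rep) = restrictPoly i b p , DegLe-restrict i b deg , SignRep-restrict {p = p} i b rep

mainTheorem8 : (n d : ℕ) → 2 ≤ n →
    (g : Cube (n ∸ 1) → Bool) → IsPTF (n ∸ 1) d g →
    (∀ (h : Cube (n ∸ 1) → Bool) → IsPTF (n ∸ 1) d h → D h ≤ D g) →
    ∀ (f : Cube n → Bool) → IsPTF n d f →
    (n ∸ 1) * D f ≤ (2 * n) * D g
mainTheorem8 (suc m) d (s≤s _) g _ g-max f f-ptf = begin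
  m * D f
    ≡⟨ ∑-D-restrict f ⟨
  ∑[ i < suc m ] (D (restrict f i true) + D (restrict f i false))
    ≤⟨ ∑-mono-≤ (λ i → +-mono-≤ (D≤Dg i true) (D≤Dg i false)) ⟩
  ∑[ i < suc m ] (D g + D g)
    ≡⟨ ∑-const (suc m) (D g + D g) ⟩
  suc m * (D g + D g)
    ≡⟨ regroup (suc m) (D g) ⟩
  2 * suc m * D g ∎
  where
  open ℕ.≤-Reasoning
  regroup : ∀ n x → n * (x + x) ≡ 2 * n * x
  regroup = solve-∀
  D≤Dg : ∀ i b → D (restrict f i b) ≤ D g
  D≤Dg i b = g-max (restrict f i b) (IsPTF-restrict i b f-ptf)
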